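{- For every $d\ge1$, the number of intervals of the Mockingbird lattice $\mathrm{M}(d)$ is $\mathbf{a}_1(d-1)$, where for every $k\ge1$ the integer sequence $\mathbf{a}_k$ is defined by $\mathbf{a}_k(0)=1$ and, for $n\ge1$, $\mathbf{a}_k(n) = \mathbf{a}_k(n-1)^2 + \sum_{i=0}^{k}\binom{k}{i}\mathbf{a}_{k+i}(n-1)$.
   Context: Terms over $\{{\rm M}\}$: the smallest set containing variables $\mathsf{x}_1,\mathsf{x}_2,\dots$, the symbol ${\rm M}$, and $(\mathfrak{t}_1\mathfrak{t}_2)$ for terms $\mathfrak{t}_1,\mathfrak{t}_2$ (application associates to the left). $\Rightarrow$ is the smallest relation with ${\rm M}\,\mathfrak{s}\Rightarrow\mathfrak{s}\,\mathfrak{s}$ for all terms $\mathfrak{s}$, closed under $\mathfrak{t}_1\Rightarrow\mathfrak{t}_1'$ implies $\mathfrak{t}_1\mathfrak{t}_2\Rightarrow\mathfrak{t}_1'\mathfrak{t}_2$ and $\mathfrak{t}_2\mathfrak{t}_1\Rightarrow\mathfrak{t}_2\mathfrak{t}_1'$; $\preccurlyeq$ is its reflexive-transitive closure (a partial order). With $\mathfrak{r}_0={\rm M}$ and $\mathfrak{r}_d = {\rm M}\,\mathfrak{r}_{d-1}$, the Mockingbird lattice $\mathrm{M}(d)$ is the set $\{\mathfrak{t} : \mathfrak{r}_d\preccurlyeq\mathfrak{t}\}$ ordered by $\preccurlyeq$. An interval is a set $\{\mathfrak{t} : \mathfrak{u}\preccurlyeq\mathfrak{t}\preccurlyeq\mathfrak{v}\}$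 for a pair $\mathfrak{u}\preccurlyeq\mathfrak{v}$ of elements of $\mathrm{M}(d)$; intervals are counted as such pairs. -}

module Defs where

open import Data.Nat using (ℕ; zero; suc; _+_; _*_; _^_)
open import Data.Nat.Combinatorics using (_C_)
open import Relation.Binary.Construct.Closure.ReflexiveTransitive using (Star)

data Term : Set where
  var : ℕ → Term
  M   : Term
  _·_ : Term → Term → Term

infixl 9 _·_

data _⇒_ : Term → Term → Set where
  root  : ∀ s → (M · s) ⇒ (s · s)
  left  : ∀ {t₁ t₁′} t₂ → t₁ ⇒ t₁′ → (t₁ · t₂) ⇒ (t₁′ · t₂)
  right : ∀ {t₁ t₁′} t₂ → t₁ ⇒ t₁′ → (t₂ · t₁) ⇒ (t₂ · t₁′)

_≼_ : Term → Term → Set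
_≼_ = Star _⇒_

r : ℕ → Term
r zero    = M
r (suc d) = M · r d

IsInterval : ℕ → Term → Term → Set
IsInterval d u v = (r d ≼ u) × (u ≼ v)
  where open import Data.Product using (_×_)

mutual
  a : ℕ → ℕ → ℕ
  a k zero    = 1
  a k (suc n) = a k n ^ 2 + sumA k n k

  sumA : ℕ → ℕ → ℕ → ℕ
  sumA k n zero    = (k C 0) * a k n
  sumA k n (suc j) = sumA k n j + (k C suc j) * a (k + suc j) n

-- The terms above r_{n+1} are built in n layers from M M: each layer consists of
-- M x and x y with x, y from the previous layer, and M x ≼ y z holds iff x ≼ y and
-- x ≼ z, while M x ≼ M y and x y ≼ x′ y′ are componentwise. Hence a_k(n) counts
-- "fans" (x, y₁, …, y_k) with x ≼ yᵢ in layer n: a fan over x y splits into two fans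
-- over x and y, and a fan over M x chooses every yᵢ as M v or v v′ with v, v′ above x,
-- which by the binomial theorem gives Σᵢ C(k,i) a_{k+i}(n-1). Intervals are the fans
-- with k = 1.
module Submission where

open import Defs
open import Data.Nat using (ℕ; _≤_; _∸_)
open import Data.Product using (Σ; _×_; _,_)
open import Data.List using (List; length)
open import Data.List.Membership.Propositional using (_∈_)
open import Data.List.Relation.Unary.Unique.Propositional using (Unique)
open import Function.Bundles using (_⇔_)
open import Relation.Binary.PropositionalEquality using (_≡_)

open import Data.Empty using (⊥-elim)
open import Data.Fin using (Fin)
open import Data.Fin.Properties using (1↔⊤; +↔⊎; *↔×)
open import Data.List using (map; allFin)
open import Data.List.Membership.Propositional.Properties using (∈-map⁺; ∈-map⁻; ∈-allFin)
open import Data.List.Properties using (length-map; length-tabulate)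
import Data.List.Relation.Unary.Unique.Propositional.Properties as Unique
open import Data.Nat using (zero; suc; _+_; _*_)
open import Data.Nat.Combinatorics using (_C_; nCk+nC[k+1]≡[n+1]C[k+1]; k>n⇒nCk≡0)
open import Data.Nat.Properties
  using (+-assoc; +-comm; +-suc; +-identityʳ; *-identityʳ; *-distribʳ-+; ≤-refl; +-commutativeSemigroup)
open import Data.Product using (proj₁; proj₂; uncurry; ∃-syntax)
open import Data.Product.Function.Dependent.Propositional using (Σ-↔)
open import Data.Product.Function.NonDependent.Propositional using (_×-cong_)
open import Data.Sum using (_⊎_; inj₁; inj₂)
open import Data.Sum.Function.Propositional using (_⊎-cong_)
open import Data.Unit using (⊤; tt)
open import Data.Vec using (Vec; []; _∷_; zip; unzip) renaming (map to mapᵥ)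
open import Data.Vec.Properties using (map-∘; map-cong; map-id; unzip∘zip; zip∘unzip)
open import Function using (_∘_)
open import Function.Bundles using (_↔_; mk↔ₛ′; mk⇔; Inverse; Injection)
open import Function.Properties.Inverse using (↔-refl; ↔-sym; ↔-trans; ↔⇒↣)
open import Function.Related.Propositional using (module EquationalReasoning)
open import Function.Related.TypeIsomorphisms using (Σ-distribˡ-⊎)
open import Relation.Binary.Construct.Closure.ReflexiveTransitive using (ε; _◅_; _◅◅_; gmap)
open import Relation.Binary.Definitions using (Reflexive; Transitive; Irrelevant)
open import Relation.Binary.PropositionalEquality
  using (refl; sym; trans; cong; cong₂; subst; _≢_; module ≡-Reasoning)
open import Relation.Nullary using (¬_)

open import Algebra.Properties.CommutativeSemigroup +-commutativeSemigroup using (interchange)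

private variable
  n k j : ℕ
  A B : Set
  t : Term

∑≤ : (ℕ → ℕ) → ℕ → ℕ
∑≤ f zero    = f zero
∑≤ f (suc j) = ∑≤ f j + f (suc j)

∑≤-cong : ∀ {f g} → (∀ i → f i ≡ g i) → ∀ j → ∑≤ f j ≡ ∑≤ g j
∑≤-cong f≗g zero    = f≗g zero
∑≤-cong f≗g (suc j) = cong₂ _+_ (∑≤-cong f≗g j) (f≗g (suc j))

∑≤-+ : ∀ f g j → ∑≤ (λ i → f i + g i) j ≡ ∑≤ f j + ∑≤ g j
∑≤-+ f g zero    = refl
∑≤-+ f g (suc j) = begin
  ∑≤ (λ i → f i + g i) j + (f (suc j) + g (suc j)) ≡⟨ cong (_+ (f (suc j) + g (suc j))) (∑≤-+ f g j) ⟩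
  (∑≤ f j + ∑≤ g j) + (f (suc j) + g (suc j))       ≡⟨ interchange (∑≤ f j) _ _ _ ⟩
  (∑≤ f j + f (suc j)) + (∑≤ g j + g (suc j))       ∎
  where open ≡-Reasoning

∑≤-suc : ∀ f j → ∑≤ f (suc j) ≡ f 0 + ∑≤ (λ i → f (suc i)) j
∑≤-suc f zero    = refl
∑≤-suc f (suc j) = begin
  ∑≤ f (suc j) + f (suc (suc j))                     ≡⟨ cong (_+ f (suc (suc j))) (∑≤-suc f j) ⟩
  f 0 + ∑≤ (λ i → f (suc i)) j + f (suc (suc j))     ≡⟨ +-assoc (f 0) _ _ ⟩
  f 0 + (∑≤ (λ i → f (suc i)) j + f (suc (suc j)))   ∎
  where open ≡-Reasoning

binomialSum : (ℕ → ℕ) → ℕ → ℕ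
binomialSum f k = ∑≤ (λ i → (k C i) * f i) k

-- Pascal's rule; (suc k C 0) * f 0 computes to f 0 + 0.
binomialSum-suc : ∀ f k → binomialSum f (suc k) ≡ binomialSum f k + binomialSum (λ i → f (suc i)) k
binomialSum-suc f k = begin
  ∑≤ (λ i → (suc k C i) * f i) (suc k)
    ≡⟨ ∑≤-suc _ k ⟩
  f 0 + 0 + ∑≤ (λ i → (suc k C suc i) * g i) k
    ≡⟨ cong (f 0 + 0 +_) (∑≤-cong pascal k) ⟩
  f 0 + 0 + ∑≤ (λ i → h i + (k C i) * g i) k
    ≡⟨ cong (f 0 + 0 +_) (∑≤-+ h _ k) ⟩
  f 0 + 0 + (∑≤ h k + binomialSum g k)
    ≡⟨ +-assoc (f 0 + 0) _ _ ⟨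
  f 0 + 0 + ∑≤ h k + binomialSum g k
    ≡⟨ cong (_+ binomialSum g k) (∑≤-suc (λ i → (k C i) * f i) k) ⟨
  ∑≤ (λ i → (k C i) * f i) (suc k) + binomialSum g k
    ≡⟨ cong (λ c → binomialSum f k + c * f (suc k) + binomialSum g k) (k>n⇒nCk≡0 {k} ≤-refl) ⟩
  binomialSum f k + 0 + binomialSum g k
    ≡⟨ cong (_+ binomialSum g k) (+-identityʳ _) ⟩
  binomialSum f k + binomialSum g k ∎
  where
  open ≡-Reasoning
  g h : ℕ → ℕ
  g i = f (suc i)
  h i = (k C suc i) * g i
  pascal : ∀ i → (suc k C suc i) * g i ≡ h i + (k C i) * g i
  pascal i = begin
    (suc k C suc i) * g i         ≡⟨ cong (_* g i) (nCk+nC[k+1]≡[n+1]C[k+1] k i) ⟨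
    ((k C i) + (k C suc i)) * g i ≡⟨ cong (_* g i) (+-comm (k C i) _) ⟩
    ((k C suc i) + (k C i)) * g i ≡⟨ *-distribʳ-+ (g i) (k C suc i) _ ⟩
    h i + (k C i) * g i           ∎

binomialSum-cong : ∀ {f g} → (∀ i → f i ≡ g i) → ∀ k → binomialSum f k ≡ binomialSum g k
binomialSum-cong f≗g k = ∑≤-cong (λ i → cong ((k C i) *_) (f≗g i)) k

-- Σ_{i ≤ k} C(k,i) s(j+k+i): the size of Σ_x Mixed k j (A x) when s m = Σ_x |A x|^m.
mixedSum : (ℕ → ℕ) → ℕ → ℕ → ℕ
mixedSum s k j = binomialSum (λ i → s (j + k + i)) k

mixedSum-zero : ∀ s j → mixedSum s 0 j ≡ s j
mixedSum-zero s j = trans (+-identityʳ _) (cong s (trans (+-identityʳ (j + 0)) (+-identityʳ j)))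

mixedSum-suc : ∀ s k j → mixedSum s (suc k) j ≡ mixedSum s k (suc j) + mixedSum s k (suc (suc j))
mixedSum-suc s k j = begin
  mixedSum s (suc k) j
    ≡⟨ binomialSum-suc (λ i → s (j + suc k + i)) k ⟩
  binomialSum (λ i → s (j + suc k + i)) k + binomialSum (λ i → s (j + suc k + suc i)) k
    ≡⟨ cong₂ _+_ (binomialSum-cong (cong s ∘ index₁) k) (binomialSum-cong (cong s ∘ index₂) k) ⟩
  mixedSum s k (suc j) + mixedSum s k (suc (suc j)) ∎
  where
  open ≡-Reasoning
  index₁ : ∀ i → j + suc k + i ≡ suc j + k + i
  index₁ i = cong (_+ i) (+-suc j k)
  index₂ : ∀ i → j + suc k + suc i ≡ suc (suc j) + k + i
  index₂ i = trans (+-suc (j + suc k) i) (cong (λ m → suc m + i) (+-suc j k))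

sumA≡∑≤ : ∀ k n j → sumA k n j ≡ ∑≤ (λ i → (k C i) * a (k + i) n) j
sumA≡∑≤ k n zero    = cong (λ m → (k C 0) * a m n) (sym (+-identityʳ k))
sumA≡∑≤ k n (suc j) = cong (_+ (k C suc j) * a (k + suc j) n) (sumA≡∑≤ k n j)

a-suc : ∀ k n → a k (suc n) ≡ a k n * a k n + mixedSum (λ i → a i n) k 0
a-suc k n = cong₂ _+_ (cong (a k n *_) (*-identityʳ (a k n))) (sumA≡∑≤ k n k)

Σ-cong↔ : ∀ {I : Set} {P Q : I → Set} → (∀ {i} → P i ↔ Q i) → Σ I P ↔ Σ I Q
Σ-cong↔ = Σ-↔ ↔-refl

Σ-×↔ : ∀ {P : A → Set} {Q : B → Set} → Σ (A × B) (λ (a , b) → P a × Q b) ↔ (Σ A P × Σ B Q)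
Σ-×↔ = mk↔ₛ′ (λ ((a , b) , p , q) → (a , p) , (b , q)) (λ ((a , p) , (b , q)) → (a , b) , p , q)
  (λ _ → refl) (λ _ → refl)

Vec-cong↔ : A ↔ B → Vec A k ↔ Vec B k
Vec-cong↔ A↔B =
  mk↔ₛ′ (mapᵥ to) (mapᵥ from) (map-inverse strictlyInverseˡ) (map-inverse strictlyInverseʳ)
  where
  open Inverse A↔B
  map-inverse : ∀ {C D : Set} {f : C → D} {g : D → C} →
                (∀ d → f (g d) ≡ d) → ∀ {k} (v : Vec D k) → mapᵥ f (mapᵥ g v) ≡ v
  map-inverse {f = f} {g} fg v = trans (sym (map-∘ f g v)) (trans (map-cong fg v) (map-id v))

Vec-×↔ : Vec (A × B) k ↔ (Vec A k × Vec B k)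
Vec-×↔ = mk↔ₛ′ unzip (uncurry zip) (uncurry unzip∘zip) zip∘unzip

Mixed : ℕ → ℕ → Set → Set
Mixed k j A = Vec (A ⊎ A × A) k × Vec A j

Mixed-zeroˡ↔ : Mixed 0 j A ↔ Vec A j
Mixed-zeroˡ↔ = mk↔ₛ′ proj₂ ([] ,_) (λ _ → refl) (λ { ([] , _) → refl })

Mixed-zeroʳ↔ : Mixed k 0 A ↔ Vec (A ⊎ A × A) k
Mixed-zeroʳ↔ = mk↔ₛ′ proj₁ (_, []) (λ _ → refl) (λ { (_ , []) → refl })

Mixed-suc↔ : Mixed (suc k) j A ↔ (Mixed k (suc j) A ⊎ Mixed k (suc (suc j)) A)
Mixed-suc↔ = mk↔ₛ′ split merge split∘merge merge∘split
  where
  split : Mixed (suc k) j A → Mixed k (suc j) A ⊎ Mixed k (suc (suc j)) A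
  split (inj₁ a ∷ bs , as)          = inj₁ (bs , a ∷ as)
  split (inj₂ (a₁ , a₂) ∷ bs , as)  = inj₂ (bs , a₁ ∷ a₂ ∷ as)
  merge : Mixed k (suc j) A ⊎ Mixed k (suc (suc j)) A → Mixed (suc k) j A
  merge (inj₁ (bs , a ∷ as))       = inj₁ a ∷ bs , as
  merge (inj₂ (bs , a₁ ∷ a₂ ∷ as)) = inj₂ (a₁ , a₂) ∷ bs , as
  split∘merge : ∀ m → split (merge m) ≡ m
  split∘merge (inj₁ (bs , a ∷ as))       = refl
  split∘merge (inj₂ (bs , a₁ ∷ a₂ ∷ as)) = refl
  merge∘split : ∀ m → merge (split m) ≡ m
  merge∘split (inj₁ a ∷ bs , as)         = refl
  merge∘split (inj₂ (a₁ , a₂) ∷ bs , as) = refl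

-- Layer n of M(n+1): ⟦_⟧ sends it onto the terms above r (suc n), with ⋆ ↦ r 1 = M M,
-- which rewrites only to itself.
data Elem : ℕ → Set where
  ⋆   : Elem zero
  M∙_ : Elem n → Elem (suc n)
  _∙_ : Elem n → Elem n → Elem (suc n)

private variable
  x y z x₁ x₂ y₁ y₂ : Elem n

infix 4 _⊑_
data _⊑_ : Elem n → Elem n → Set where
  ⋆⊑⋆   : ⋆ ⊑ ⋆
  M∙⊑M∙ : x ⊑ y → M∙ x ⊑ M∙ y
  M∙⊑∙  : x ⊑ y → x ⊑ z → M∙ x ⊑ y ∙ z
  ∙⊑∙   : x₁ ⊑ y₁ → x₂ ⊑ y₂ → x₁ ∙ x₂ ⊑ y₁ ∙ y₂

⊑-refl : Reflexive (_⊑_ {n})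
⊑-refl {x = ⋆}     = ⋆⊑⋆
⊑-refl {x = M∙ x}  = M∙⊑M∙ ⊑-refl
⊑-refl {x = x ∙ y} = ∙⊑∙ ⊑-refl ⊑-refl

⊑-trans : Transitive (_⊑_ {n})
⊑-trans ⋆⊑⋆         ⋆⊑⋆         = ⋆⊑⋆
⊑-trans (M∙⊑M∙ p)   (M∙⊑M∙ q)   = M∙⊑M∙ (⊑-trans p q)
⊑-trans (M∙⊑M∙ p)   (M∙⊑∙ q₁ q₂) = M∙⊑∙ (⊑-trans p q₁) (⊑-trans p q₂)
⊑-trans (M∙⊑∙ p₁ p₂) (∙⊑∙ q₁ q₂)  = M∙⊑∙ (⊑-trans p₁ q₁) (⊑-trans p₂ q₂)
⊑-trans (∙⊑∙ p₁ p₂)  (∙⊑∙ q₁ q₂)  = ∙⊑∙ (⊑-trans p₁ q₁) (⊑-trans p₂ q₂)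

⊑-irrelevant : Irrelevant (_⊑_ {n})
⊑-irrelevant ⋆⊑⋆          ⋆⊑⋆          = refl
⊑-irrelevant (M∙⊑M∙ p)    (M∙⊑M∙ q)    = cong M∙⊑M∙ (⊑-irrelevant p q)
⊑-irrelevant (M∙⊑∙ p₁ p₂) (M∙⊑∙ q₁ q₂) = cong₂ M∙⊑∙ (⊑-irrelevant p₁ q₁) (⊑-irrelevant p₂ q₂)
⊑-irrelevant (∙⊑∙ p₁ p₂)  (∙⊑∙ q₁ q₂)  = cong₂ ∙⊑∙ (⊑-irrelevant p₁ q₁) (⊑-irrelevant p₂ q₂)

bottom : ∀ n → Elem n
bottom zero    = ⋆
bottom (suc n) = M∙ bottom n

bottom-least : ∀ (x : Elem n) → bottom n ⊑ x
bottom-least ⋆       = ⋆⊑⋆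
bottom-least (M∙ x)  = M∙⊑M∙ (bottom-least x)
bottom-least (x ∙ y) = M∙⊑∙ (bottom-least x) (bottom-least y)

⟦_⟧ : Elem n → Term
⟦ ⋆ ⟧     = M · M
⟦ M∙ x ⟧  = M · ⟦ x ⟧
⟦ x ∙ y ⟧ = ⟦ x ⟧ · ⟦ y ⟧

⟦bottom⟧ : ∀ n → ⟦ bottom n ⟧ ≡ r (suc n)
⟦bottom⟧ zero    = refl
⟦bottom⟧ (suc n) = cong (M ·_) (⟦bottom⟧ n)

⟦⟧≢M : ∀ (x : Elem n) → ⟦ x ⟧ ≢ M
⟦⟧≢M ⋆ ()
⟦⟧≢M (M∙ x) ()
⟦⟧≢M (x ∙ y) ()

·-injective : ∀ {s t s′ t′} → s · t ≡ s′ · t′ → s ≡ s′ × t ≡ t′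
·-injective refl = refl , refl

⟦⟧-injective : ⟦ x ⟧ ≡ ⟦ y ⟧ → x ≡ y
⟦⟧-injective {x = ⋆}       {y = ⋆}       _  = refl
⟦⟧-injective {x = M∙ x}    {y = M∙ y}    eq = cong M∙_ (⟦⟧-injective (proj₂ (·-injective eq)))
⟦⟧-injective {x = M∙ x}    {y = y₁ ∙ y₂} eq = ⊥-elim (⟦⟧≢M y₁ (sym (proj₁ (·-injective eq))))
⟦⟧-injective {x = x₁ ∙ x₂} {y = M∙ y}    eq = ⊥-elim (⟦⟧≢M x₁ (proj₁ (·-injective eq)))
⟦⟧-injective {x = x₁ ∙ x₂} {y = y₁ ∙ y₂} eq =
  let eq₁ , eq₂ = ·-injective eq in cong₂ _∙_ (⟦⟧-injective eq₁) (⟦⟧-injective eq₂)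

M-normal : ¬ (M ⇒ t)
M-normal ()

ImageAbove : Term → Elem n → Set
ImageAbove t x = ∃[ y ] t ≡ ⟦ y ⟧ × x ⊑ y

M∙-lift : ImageAbove t x → ImageAbove (M · t) (M∙ x)
M∙-lift (y , refl , x⊑y) = M∙ y , refl , M∙⊑M∙ x⊑y

∙-liftˡ : ∀ x₂ → ImageAbove t x₁ → ImageAbove (t · ⟦ x₂ ⟧) (x₁ ∙ x₂)
∙-liftˡ x₂ (y , refl , x⊑y) = y ∙ x₂ , refl , ∙⊑∙ x⊑y ⊑-refl

∙-liftʳ : ∀ x₁ → ImageAbove t x₂ → ImageAbove (⟦ x₁ ⟧ · t) (x₁ ∙ x₂)
∙-liftʳ x₁ (y , refl , x⊑y) = x₁ ∙ y , refl , ∙⊑∙ ⊑-refl x⊑y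

-- In the left-step clauses the head of x₁ ∙ x₂ is split so that the root rule visibly cannot apply.
⟦⟧-step : ∀ (x : Elem n) → ⟦ x ⟧ ⇒ t → ImageAbove t x
⟦⟧-step ⋆              (root M)    = ⋆ , refl , ⋆⊑⋆
⟦⟧-step ⋆              (left _ s)  = ⊥-elim (M-normal s)
⟦⟧-step ⋆              (right _ s) = ⊥-elim (M-normal s)
⟦⟧-step (M∙ x)         (root _)    = x ∙ x , refl , M∙⊑∙ ⊑-refl ⊑-refl
⟦⟧-step (M∙ x)         (left _ s)  = ⊥-elim (M-normal s)
⟦⟧-step (M∙ x)         (right _ s) = M∙-lift (⟦⟧-step x s)
⟦⟧-step (⋆ ∙ x₂)       (left _ s)  = ∙-liftˡ x₂ (⟦⟧-step ⋆ s)
⟦⟧-step ((M∙ x) ∙ x₂)  (left _ s)  = ∙-liftˡ x₂ (⟦⟧-step (M∙ x) s)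
⟦⟧-step ((y ∙ z) ∙ x₂) (left _ s)  = ∙-liftˡ x₂ (⟦⟧-step (y ∙ z) s)
⟦⟧-step (x₁ ∙ x₂)      (right _ s) = ∙-liftʳ x₁ (⟦⟧-step x₂ s)

⟦⟧-steps : ∀ (x : Elem n) → ⟦ x ⟧ ≼ t → ImageAbove t x
⟦⟧-steps x ε        = x , refl , ⊑-refl
⟦⟧-steps x (s ◅ ss) with ⟦⟧-step x s
... | y , refl , x⊑y with ⟦⟧-steps y ss
...   | z , t≡z , y⊑z = z , t≡z , ⊑-trans x⊑y y⊑z

·-≼ : ∀ {s s′ u u′} → s ≼ s′ → u ≼ u′ → (s · u) ≼ (s′ · u′)
·-≼ {s′ = s′} {u = u} s≼s′ u≼u′ = gmap (_· u) (left u) s≼s′ ◅◅ gmap (s′ ·_) (right s′) u≼u′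

⊑⇒≼ : x ⊑ y → ⟦ x ⟧ ≼ ⟦ y ⟧
⊑⇒≼ ⋆⊑⋆                       = ε
⊑⇒≼ (M∙⊑M∙ x⊑y)               = gmap (M ·_) (right M) (⊑⇒≼ x⊑y)
⊑⇒≼ {x = M∙ x} (M∙⊑∙ x⊑y x⊑z) = root ⟦ x ⟧ ◅ ·-≼ (⊑⇒≼ x⊑y) (⊑⇒≼ x⊑z)
⊑⇒≼ (∙⊑∙ x₁⊑y₁ x₂⊑y₂)         = ·-≼ (⊑⇒≼ x₁⊑y₁) (⊑⇒≼ x₂⊑y₂)

⊑⇒interval : {x y : Elem n} → x ⊑ y → IsInterval (suc n) ⟦ x ⟧ ⟦ y ⟧
⊑⇒interval {x = x} x⊑y = subst (_≼ ⟦ x ⟧) (⟦bottom⟧ _) (⊑⇒≼ (bottom-least x)) , ⊑⇒≼ x⊑y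

interval⇒⊑ : ∀ {u v} → IsInterval (suc n) u v → ∃[ x ] ∃[ y ] x ⊑ y × u ≡ ⟦ x ⟧ × v ≡ ⟦ y ⟧
interval⇒⊑ {n} {u} (r≼u , u≼v) with ⟦⟧-steps (bottom n) (subst (_≼ u) (sym (⟦bottom⟧ n)) r≼u)
... | x , refl , _ with ⟦⟧-steps x u≼v
...   | y , refl , x⊑y = x , y , x⊑y , refl , refl

Above : Elem n → Set
Above {n} x = Σ (Elem n) (x ⊑_)

above-∙↔ : Above (x₁ ∙ x₂) ↔ (Above x₁ × Above x₂)
above-∙↔ = mk↔ₛ′ (λ { (y₁ ∙ y₂ , ∙⊑∙ p₁ p₂) → (y₁ , p₁) , (y₂ , p₂) })
  (λ ((y₁ , p₁) , (y₂ , p₂)) → y₁ ∙ y₂ , ∙⊑∙ p₁ p₂) (λ _ → refl) (λ { (_ ∙ _ , ∙⊑∙ _ _) → refl })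

above-M∙↔ : Above (M∙ x) ↔ (Above x ⊎ Above x × Above x)
above-M∙↔ = mk↔ₛ′ to from (λ { (inj₁ _) → refl ; (inj₂ _) → refl })
  (λ { (M∙ _ , M∙⊑M∙ _) → refl ; (_ ∙ _ , M∙⊑∙ _ _) → refl })
  where
  to : Above (M∙ x) → Above x ⊎ Above x × Above x
  to (M∙ y , M∙⊑M∙ p)     = inj₁ (y , p)
  to (y ∙ z , M∙⊑∙ p q)   = inj₂ ((y , p) , (z , q))
  from : Above x ⊎ Above x × Above x → Above (M∙ x)
  from (inj₁ (y , p))            = M∙ y , M∙⊑M∙ p
  from (inj₂ ((y , p) , (z , q))) = y ∙ z , M∙⊑∙ p q

Σ-Elem-suc↔ : ∀ {P : Elem (suc n) → Set} →
  Σ (Elem (suc n)) P ↔ (Σ (Elem n × Elem n) (λ (x₁ , x₂) → P (x₁ ∙ x₂)) ⊎ Σ (Elem n) (P ∘ M∙_))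
Σ-Elem-suc↔ {n} {P} = mk↔ₛ′ to from (λ { (inj₁ _) → refl ; (inj₂ _) → refl })
  (λ { (M∙ _ , _) → refl ; (_ ∙ _ , _) → refl })
  where
  to : Σ (Elem (suc n)) P → Σ (Elem n × Elem n) (λ (x₁ , x₂) → P (x₁ ∙ x₂)) ⊎ Σ (Elem n) (P ∘ M∙_)
  to (x₁ ∙ x₂ , p) = inj₁ ((x₁ , x₂) , p)
  to (M∙ x , p)    = inj₂ (x , p)
  from : Σ (Elem n × Elem n) (λ (x₁ , x₂) → P (x₁ ∙ x₂)) ⊎ Σ (Elem n) (P ∘ M∙_) → Σ (Elem (suc n)) P
  from (inj₁ ((x₁ , x₂) , p)) = x₁ ∙ x₂ , p
  from (inj₂ (x , p))         = M∙ x , p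

Fan : ℕ → ℕ → Set
Fan k n = Σ (Elem n) λ x → Vec (Above x) k

MixedFan : ℕ → ℕ → ℕ → Set
MixedFan k j n = Σ (Elem n) λ x → Mixed k j (Above x)

fan-zero↔ : Fan k 0 ↔ ⊤
fan-zero↔ {k} = mk↔ₛ′ (λ _ → tt) (λ _ → ⋆ , stars k) (λ _ → refl)
  (λ { (⋆ , v) → cong (⋆ ,_) (stars-unique v) })
  where
  stars : ∀ k → Vec (Above ⋆) k
  stars zero    = []
  stars (suc k) = (⋆ , ⋆⊑⋆) ∷ stars k
  stars-unique : ∀ {k} (v : Vec (Above ⋆) k) → stars k ≡ v
  stars-unique []                = refl
  stars-unique ((⋆ , ⋆⊑⋆) ∷ v) = cong (_ ∷_) (stars-unique v)

fan-suc↔ : Fan k (suc n) ↔ ((Fan k n × Fan k n) ⊎ MixedFan k 0 n)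
fan-suc↔ {k} {n} = begin
  Fan k (suc n)
    ↔⟨ Σ-Elem-suc↔ ⟩
  (Σ (Elem n × Elem n) (λ (x₁ , x₂) → Vec (Above (x₁ ∙ x₂)) k) ⊎ Σ (Elem n) (λ x → Vec (Above (M∙ x)) k))
    ↔⟨ Σ-cong↔ (↔-trans (Vec-cong↔ above-∙↔) Vec-×↔)
       ⊎-cong Σ-cong↔ (↔-trans (Vec-cong↔ above-M∙↔) (↔-sym Mixed-zeroʳ↔)) ⟩
  (Σ (Elem n × Elem n) (λ (x₁ , x₂) → Vec (Above x₁) k × Vec (Above x₂) k) ⊎ MixedFan k 0 n)
    ↔⟨ Σ-×↔ ⊎-cong ↔-refl ⟩
  ((Fan k n × Fan k n) ⊎ MixedFan k 0 n) ∎
  where open EquationalReasoning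

mixedFan↔ : (∀ j → Fin (a j n) ↔ Fan j n) → ∀ k j → Fin (mixedSum (λ i → a i n) k j) ↔ MixedFan k j n
mixedFan↔ {n} fan↔ₙ zero j = begin
  Fin (mixedSum (λ i → a i n) 0 j) ≡⟨ cong Fin (mixedSum-zero (λ i → a i n) j) ⟩
  Fin (a j n)                      ↔⟨ fan↔ₙ j ⟩
  Fan j n                          ↔⟨ Σ-cong↔ (↔-sym Mixed-zeroˡ↔) ⟩
  MixedFan 0 j n                   ∎
  where open EquationalReasoning
mixedFan↔ {n} fan↔ₙ (suc k) j = begin
  Fin (mixedSum s (suc k) j)
    ≡⟨ cong Fin (mixedSum-suc s k j) ⟩
  Fin (mixedSum s k (suc j) + mixedSum s k (suc (suc j)))
    ↔⟨ +↔⊎ ⟩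
  (Fin (mixedSum s k (suc j)) ⊎ Fin (mixedSum s k (suc (suc j))))
    ↔⟨ mixedFan↔ fan↔ₙ k (suc j) ⊎-cong mixedFan↔ fan↔ₙ k (suc (suc j)) ⟩
  (MixedFan k (suc j) n ⊎ MixedFan k (suc (suc j)) n)
    ↔⟨ Σ-distribˡ-⊎ ⟨
  Σ (Elem n) (λ x → Mixed k (suc j) (Above x) ⊎ Mixed k (suc (suc j)) (Above x))
    ↔⟨ Σ-cong↔ (↔-sym Mixed-suc↔) ⟩
  MixedFan (suc k) j n ∎
  where
  open EquationalReasoning
  s : ℕ → ℕ
  s i = a i n

fan↔ : ∀ n k → Fin (a k n) ↔ Fan k n
fan↔ zero k = begin
  Fin 1     ↔⟨ 1↔⊤ ⟩
  ⊤         ↔⟨ fan-zero↔ ⟨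
  Fan k 0   ∎
  where open EquationalReasoning
fan↔ (suc n) k = begin
  Fin (a k (suc n))
    ≡⟨ cong Fin (a-suc k n) ⟩
  Fin (a k n * a k n + mixedSum (λ i → a i n) k 0)
    ↔⟨ +↔⊎ ⟩
  (Fin (a k n * a k n) ⊎ Fin (mixedSum (λ i → a i n) k 0))
    ↔⟨ ↔-trans *↔× (fan↔ n k ×-cong fan↔ n k) ⊎-cong mixedFan↔ (fan↔ n) k 0 ⟩
  ((Fan k n × Fan k n) ⊎ MixedFan k 0 n)
    ↔⟨ fan-suc↔ ⟨
  Fan k (suc n) ∎
  where open EquationalReasoning

endpoints : Fan 1 n → Term × Term
endpoints (x , (y , _) ∷ []) = ⟦ x ⟧ , ⟦ y ⟧

endpoints-injective : ∀ {f g : Fan 1 n} → endpoints f ≡ endpoints g → f ≡ g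
endpoints-injective {f = x , (y , x⊑y) ∷ []} {g = x′ , (y′ , x′⊑y′) ∷ []} eq
  with ⟦⟧-injective (cong proj₁ eq) | ⟦⟧-injective (cong proj₂ eq)
... | refl | refl rewrite ⊑-irrelevant x⊑y x′⊑y′ = refl

intervals : ℕ → List (Term × Term)
intervals n = map (endpoints ∘ Inverse.to (fan↔ n 1)) (allFin (a 1 n))

intervals-unique : ∀ n → Unique (intervals n)
intervals-unique n =
  Unique.map⁺ (Injection.injective (↔⇒↣ (fan↔ n 1)) ∘ endpoints-injective) (Unique.allFin⁺ (a 1 n))

length-intervals : ∀ n → length (intervals n) ≡ a 1 n
length-intervals n = trans (length-map _ (allFin (a 1 n))) (length-tabulate _)

∈-intervals⇔ : ∀ n {u v} → (u , v) ∈ intervals n ⇔ IsInterval (suc n) u v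
∈-intervals⇔ n {u} {v} = mk⇔ sound complete
  where
  open Inverse (fan↔ n 1)
  sound : (u , v) ∈ intervals n → IsInterval (suc n) u v
  sound u,v∈ with ∈-map⁻ (endpoints ∘ to) u,v∈
  ... | i , _ , eq with to i | eq
  ...   | x , (y , x⊑y) ∷ [] | refl = ⊑⇒interval x⊑y
  complete : IsInterval (suc n) u v → (u , v) ∈ intervals n
  complete u≼v with interval⇒⊑ u≼v
  ... | x , y , x⊑y , refl , refl =
    subst (λ f → endpoints f ∈ intervals n) (strictlyInverseˡ (x , (y , x⊑y) ∷ []))
      (∈-map⁺ (endpoints ∘ to) (∈-allFin (from (x , (y , x⊑y) ∷ []))))

mainTheorem17 : (d : ℕ) → 1 ≤ d →
    Σ (List (Term × Term)) λ L →
      Unique L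
      × ((u v : Term) → ((u , v) ∈ L) ⇔ IsInterval d u v)
      × (length L ≡ a 1 (d ∸ 1))
mainTheorem17 (suc n) _ =
  intervals n , intervals-unique n , (λ _ _ → ∈-intervals⇔ n) , length-intervals n
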